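{- Let $G=([n],E)$ be a simple graph. For $i\in[n]$ let $I_i$ be the sequence listing the set $\{j: \{j,i\}\in E,\ j<i\}$ in decreasing order, and let $v=I_1I_2\cdots I_n$ be their concatenation. If $v$ contains the sequence $abababab$ (with $a\ne b$), then there exist vertices $1\le v_1<v_2<\dots<v_6\le n$ such that $\{v_1,v_3\},\{v_1,v_5\},\{v_2,v_4\},\{v_2,v_6\}\in E$.
   Context: For finite sequences $u=a_1\cdots a_r$ and $v=b_1\cdots b_s$, $v$ contains $u$ if $v$ has a subsequence $b_{i_1}b_{i_2}\cdots b_{i_r}$ ($i_1<\dots<i_r$) such that for all $p,q$, $a_p=a_q$ iff $b_{i_p}=b_{i_q}$. Thus $v$ contains $abababab$ iff $v$ has a subsequence alternating between two distinct symbols with 8 terms. -}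

module Defs where

open import Data.Nat using (ℕ; zero; suc; _<_; _≤_)
open import Data.Bool using (Bool; true; false; if_then_else_)
open import Data.List using (List; []; _∷_; _++_)
open import Relation.Binary.PropositionalEquality using (_≡_)
open import Data.Product using (_×_)

-- A simple graph on vertex set [n] = {1,…,n}: a Boolean adjacency
-- function on ℕ that is symmetric and irreflexive on [n].
-- Edge {j,i} ∈ E  iff  adj j i ≡ true.
record SimpleGraph (n : ℕ) : Set where
  field
    adj   : ℕ → ℕ → Bool
    sym   : ∀ i j → 1 ≤ i → i ≤ n → 1 ≤ j → j ≤ n → adj i j ≡ adj j i
    irrefl : ∀ i → 1 ≤ i → i ≤ n → adj i i ≡ false
open SimpleGraph public

Edge : ∀ {n} → SimpleGraph n → ℕ → ℕ → Set
Edge {n} G i j = (1 ≤ i × i ≤ n) × (1 ≤ j × j ≤ n) × adj G i j ≡ true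

downNbrs : ∀ {n} → SimpleGraph n → ℕ → ℕ → List ℕ
downNbrs G i zero = []
downNbrs G i (suc k) =
  if adj G (suc k) i then suc k ∷ downNbrs G i k else downNbrs G i k

I : ∀ {n} → SimpleGraph n → ℕ → List ℕ
I G zero = []
I G (suc i) = downNbrs G (suc i) i

word : ∀ {n} → SimpleGraph n → ℕ → List ℕ
word G zero = []
word G (suc m) = word G m ++ I G (suc m)

v : ∀ {n} → SimpleGraph n → List ℕ
v {n} G = word G n

abababab : ℕ → ℕ → List ℕ
abababab a b = a ∷ b ∷ a ∷ b ∷ a ∷ b ∷ a ∷ b ∷ []

-- Record every letter of v together with the index j of the block I_j it is read from.
-- Along v the block index never decreases, and inside one block the letters strictly
-- decrease, so whenever the letter goes up the block index must go up too. Dropping the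
-- first or the last letter of abababab leaves a subsequence q p q p q p q of v with
-- p < q, read from blocks j₁ ≤ ⋯ ≤ j₇; its three ascents p → q give j₂ < j₃, j₄ < j₅
-- and j₆ < j₇, and q < j₁ ≤ j₂ since letters precede their block. The vertices
-- p < q < j₂ < j₃ < j₆ < j₇ then carry the edges pj₂, pj₆, qj₃, qj₇.
module Submission where

open import Defs hiding (sym)
open import Data.Nat using (ℕ; _<_; _≤_; _>_; zero; suc; z≤n; s≤s)
open import Data.Nat.Properties
  using (≤-refl; <⇒≤; <⇒≱; <-≤-trans; ≤-<-trans; ≤-trans; m≤n⇒m≤1+n; n≤1+n; <-cmp)
open import Data.Product using (_×_; ∃-syntax; _,_)
open import Data.Sum using (_⊎_; inj₁; inj₂)
open import Data.Empty using (⊥-elim)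
open import Data.Bool using (true; false)
open import Data.List using (List; []; _∷_; _++_; map)
open import Data.List.Properties using (map-id; map-∘; map-++)
open import Function using (id)
open import Data.List.Relation.Unary.All as All using (All; []; _∷_)
import Data.List.Relation.Unary.All.Properties as All
open import Data.List.Relation.Unary.AllPairs as AllPairs using (AllPairs; []; _∷_)
import Data.List.Relation.Unary.AllPairs.Properties as AllPairs
open import Data.List.Relation.Unary.Linked using (Linked; [-]; _∷_)
open import Data.List.Relation.Unary.Linked.Properties using (AllPairs⇒Linked)
open import Data.List.Relation.Binary.Pointwise using (Pointwise; []; _∷_)
open import Data.List.Relation.Binary.Sublist.Propositional using (_⊆_; []; _∷_; _∷ʳ_; ⊆-refl; ⊆-trans)
open import Data.List.Relation.Binary.Sublist.Propositional.Properties using (All-resp-⊆; ∷ˡ⁻; ++⁺ʳ)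
open import Relation.Binary.Definitions using (tri<; tri≈; tri>)
open import Relation.Binary.PropositionalEquality
  using (_≡_; _≢_; refl; sym; cong₂; subst; module ≡-Reasoning)

AllPairs-resp-⊇ : ∀ {A : Set} {R : A → A → Set} {xs ys : List A} →
                  xs ⊆ ys → AllPairs R ys → AllPairs R xs
AllPairs-resp-⊇ []             []         = []
AllPairs-resp-⊇ (_ ∷ʳ xs⊆ys)   (_ ∷ rys)  = AllPairs-resp-⊇ xs⊆ys rys
AllPairs-resp-⊇ (refl ∷ xs⊆ys) (ry ∷ rys) = All-resp-⊆ xs⊆ys ry ∷ AllPairs-resp-⊇ xs⊆ys rys

record Occurrence : Set where
  constructor _at_
  field
    letter block : ℕ
open Occurrence

-- o ≺ o′ : o is read before o′ in v
_≺_ : Occurrence → Occurrence → Set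
o ≺ o′ = block o < block o′ ⊎ (block o ≡ block o′ × letter o′ < letter o)

≺⇒block≤ : ∀ {o o′} → o ≺ o′ → block o ≤ block o′
≺⇒block≤ (inj₁ i<j)        = <⇒≤ i<j
≺⇒block≤ (inj₂ (refl , _)) = ≤-refl

≺-ascent⇒block< : ∀ {o o′} → o ≺ o′ → letter o ≤ letter o′ → block o < block o′
≺-ascent⇒block< (inj₁ i<j)           _   = i<j
≺-ascent⇒block< (inj₂ (refl , y′<y)) y≤y′ = ⊥-elim (<⇒≱ y′<y y≤y′)

_IsLetterOf_ : ℕ → Occurrence → Set
x IsLetterOf o = ∃[ j ] o ≡ x at j

⊆-letters⁻ : ∀ {xs} os → xs ⊆ map letter os →
             ∃[ zs ] zs ⊆ os × Pointwise _IsLetterOf_ xs zs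
⊆-letters⁻ []       []           = [] , [] , []
⊆-letters⁻ (o ∷ os) (_ ∷ʳ xs⊆os) =
  let zs , zs⊆os , letters = ⊆-letters⁻ os xs⊆os in zs , o ∷ʳ zs⊆os , letters
⊆-letters⁻ (o ∷ os) (refl ∷ xs⊆os) =
  let zs , zs⊆os , letters = ⊆-letters⁻ os xs⊆os
  in o ∷ zs , refl ∷ zs⊆os , (block o , refl) ∷ letters

HasInterleavedNeighbours : ∀ {n} → SimpleGraph n → Set
HasInterleavedNeighbours {n} G =
  ∃[ v₁ ] ∃[ v₂ ] ∃[ v₃ ] ∃[ v₄ ] ∃[ v₅ ] ∃[ v₆ ]
    (1 ≤ v₁ × v₁ < v₂ × v₂ < v₃ × v₃ < v₄ × v₄ < v₅ × v₅ < v₆ × v₆ ≤ n)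
    × Edge G v₁ v₃ × Edge G v₁ v₅ × Edge G v₂ v₄ × Edge G v₂ v₆

module _ {n : ℕ} (G : SimpleGraph n) where

  IsOccurrence : ℕ → Occurrence → Set
  IsOccurrence m o =
    1 ≤ letter o × letter o < block o × block o ≤ m × adj G (letter o) (block o) ≡ true

  IsOccurrence-mono : ∀ {m m′} → m ≤ m′ → ∀ {o} → IsOccurrence m o → IsOccurrence m′ o
  IsOccurrence-mono m≤m′ (1≤y , y<j , j≤m , yj) = 1≤y , y<j , ≤-trans j≤m m≤m′ , yj

  IsOccurrence⇒Edge : ∀ {o} → IsOccurrence n o → Edge G (letter o) (block o)
  IsOccurrence⇒Edge (1≤y , y<j , j≤n , yj) =
    (1≤y , ≤-trans (<⇒≤ y<j) j≤n) , (≤-trans 1≤y (<⇒≤ y<j) , j≤n) , yj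

  IsDownNbr : ℕ → ℕ → ℕ → Set
  IsDownNbr i k y = 1 ≤ y × y ≤ k × adj G y i ≡ true

  IsDownNbr-suc : ∀ {i k y} → IsDownNbr i k y → IsDownNbr i (suc k) y
  IsDownNbr-suc (1≤y , y≤k , yi) = 1≤y , m≤n⇒m≤1+n y≤k , yi

  downNbrs-bounded : ∀ i k → All (IsDownNbr i k) (downNbrs G i k)
  downNbrs-bounded i zero = []
  downNbrs-bounded i (suc k) with adj G (suc k) i in adjacent
  ... | true  = (s≤s z≤n , ≤-refl , adjacent) ∷ All.map IsDownNbr-suc (downNbrs-bounded i k)
  ... | false = All.map IsDownNbr-suc (downNbrs-bounded i k)

  downNbrs-decreasing : ∀ i k → AllPairs _>_ (downNbrs G i k)
  downNbrs-decreasing i zero = []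
  downNbrs-decreasing i (suc k) with adj G (suc k) i
  ... | true  = All.map (λ { (_ , y≤k , _) → s≤s y≤k }) (downNbrs-bounded i k)
              ∷ downNbrs-decreasing i k
  ... | false = downNbrs-decreasing i k

  occurrences : ℕ → List Occurrence
  occurrences zero    = []
  occurrences (suc m) = occurrences m ++ map (_at suc m) (I G (suc m))

  word≡letters : ∀ m → word G m ≡ map letter (occurrences m)
  word≡letters zero    = refl
  word≡letters (suc m) = begin
    word G m ++ I G (suc m)
      ≡⟨ cong₂ _++_ (word≡letters m) (sym (map-id (I G (suc m)))) ⟩
    map letter (occurrences m) ++ map id (I G (suc m))
      ≡⟨ cong₂ _++_ refl (map-∘ (I G (suc m))) ⟩
    map letter (occurrences m) ++ map letter (map (_at suc m) (I G (suc m)))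
      ≡⟨ sym (map-++ letter (occurrences m) _) ⟩
    map letter (occurrences (suc m)) ∎
    where open ≡-Reasoning

  occurrences-valid : ∀ m → All (IsOccurrence m) (occurrences m)
  occurrences-valid zero    = []
  occurrences-valid (suc m) =
    All.++⁺ (All.map (IsOccurrence-mono (n≤1+n m)) (occurrences-valid m))
            (All.map⁺ (All.map in-last-block (downNbrs-bounded (suc m) m)))
    where
    in-last-block : ∀ {y} → IsDownNbr (suc m) m y → IsOccurrence (suc m) (y at suc m)
    in-last-block (1≤y , y≤m , yj) = 1≤y , s≤s y≤m , ≤-refl , yj

  occurrences-sorted : ∀ m → AllPairs _≺_ (occurrences m)
  occurrences-sorted zero    = []
  occurrences-sorted (suc m) =
    AllPairs.++⁺ (occurrences-sorted m)
                 (AllPairs.map⁺ (AllPairs.map (λ y>y′ → inj₂ (refl , y>y′))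
                                              (downNbrs-decreasing (suc m) m)))
                 (All.map earlier-block (occurrences-valid m))
    where
    earlier-block : ∀ {o} → IsOccurrence m o → All (o ≺_) (map (_at suc m) (I G (suc m)))
    earlier-block (_ , _ , j≤m , _) = All.map⁺ (All.universal (λ _ → inj₁ (s≤s j≤m)) _)

  alternating-occurrences : ∀ {p q zs} → p < q →
    Pointwise _IsLetterOf_ (q ∷ p ∷ q ∷ p ∷ q ∷ p ∷ q ∷ []) zs →
    All (IsOccurrence n) zs → Linked _≺_ zs → HasInterleavedNeighbours G
  alternating-occurrences {p} {q} p<q
    ((j₁ , refl) ∷ (j₂ , refl) ∷ (j₃ , refl) ∷ (j₄ , refl) ∷
     (j₅ , refl) ∷ (j₆ , refl) ∷ (j₇ , refl) ∷ [])
    ((_ , q<j₁ , _) ∷ o₂@(1≤p , _) ∷ o₃ ∷ _ ∷ _ ∷ o₆ ∷ o₇@(_ , _ , j₇≤n , _) ∷ [])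
    (s₁₂ ∷ s₂₃ ∷ s₃₄ ∷ s₄₅ ∷ s₅₆ ∷ s₆₇ ∷ [-]) =
    p , q , j₂ , j₃ , j₆ , j₇ ,
    (1≤p , p<q , q<j₂ , j₂<j₃ , j₃<j₆ , j₆<j₇ , j₇≤n) ,
    IsOccurrence⇒Edge o₂ , IsOccurrence⇒Edge o₆ , IsOccurrence⇒Edge o₃ , IsOccurrence⇒Edge o₇
    where
    q<j₂  = <-≤-trans q<j₁ (≺⇒block≤ s₁₂)
    j₂<j₃ = ≺-ascent⇒block< s₂₃ (<⇒≤ p<q)
    j₃<j₆ = ≤-<-trans (≺⇒block≤ s₃₄) (<-≤-trans (≺-ascent⇒block< s₄₅ (<⇒≤ p<q)) (≺⇒block≤ s₅₆))
    j₆<j₇ = ≺-ascent⇒block< s₆₇ (<⇒≤ p<q)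

  alternation⇒interleaved : ∀ {p q} → p < q →
    q ∷ p ∷ q ∷ p ∷ q ∷ p ∷ q ∷ [] ⊆ v G → HasInterleavedNeighbours G
  alternation⇒interleaved p<q qpqpqpq⊆v =
    let zs , zs⊆occ , letters =
          ⊆-letters⁻ (occurrences n) (subst (_ ⊆_) (word≡letters n) qpqpqpq⊆v)
    in alternating-occurrences p<q letters
         (All-resp-⊆ zs⊆occ (occurrences-valid n))
         (AllPairs⇒Linked (AllPairs-resp-⊇ zs⊆occ (occurrences-sorted n)))

lemma1 : (n : ℕ) (G : SimpleGraph n) (a b : ℕ) → a ≢ b → abababab a b ⊆ v G →
    ∃[ v₁ ] ∃[ v₂ ] ∃[ v₃ ] ∃[ v₄ ] ∃[ v₅ ] ∃[ v₆ ]
      (1 ≤ v₁ × v₁ < v₂ × v₂ < v₃ × v₃ < v₄ × v₄ < v₅ × v₅ < v₆ × v₆ ≤ n)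
      × Edge G v₁ v₃ × Edge G v₁ v₅ × Edge G v₂ v₄ × Edge G v₂ v₆
lemma1 n G a b a≢b abababab⊆v with <-cmp a b
... | tri< a<b _ _ = alternation⇒interleaved G a<b (∷ˡ⁻ abababab⊆v)
... | tri≈ _ a≡b _ = ⊥-elim (a≢b a≡b)
... | tri> _ _ b<a = alternation⇒interleaved G b<a (⊆-trans (++⁺ʳ _ ⊆-refl) abababab⊆v)
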